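{- Let $G$ be a non-trivial finite group. Then $\mathrm{Endo}(G)$ is a tree if and only if $G \cong \mathbb{Z}_2$.
   Context: For a finite group $G$, $\mathrm{Endo}(G)$ is the simple undirected graph with vertex set $G$ in which distinct $a,b$ are adjacent iff there is a group endomorphism of $G$ mapping $a$ to $b$ or mapping $b$ to $a$. -}

module Defs where

open import Level using (0ℓ)
open import Data.Nat using (ℕ; _≤_)
open import Data.Fin using (Fin; zero; suc)
open import Data.Product using (Σ; ∃; _×_; _,_)
open import Data.Sum using (_⊎_)
open import Data.List using (List; []; _∷_; _++_; [_]; length)
open import Data.List.Relation.Unary.Linked using (Linked)
open import Data.List.Relation.Unary.Unique.Propositional using (Unique)
open import Relation.Nullary using (¬_)
open import Relation.Binary.PropositionalEquality using (_≡_; _≢_; refl; cong₂; isEquivalence)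
open import Algebra.Structures using (IsGroup)
open import Algebra.Bundles.Raw using (RawGroup)
open import Algebra.Morphism.Structures using (module GroupMorphisms)

-- Finite groups: a group structure (with propositional equality) on
-- the carrier Fin order.  Every finite group is isomorphic to one of
-- these.

record FiniteGroup : Set where
  field
    order   : ℕ
    _∙_     : Fin order → Fin order → Fin order
    ε       : Fin order
    _⁻¹     : Fin order → Fin order
    isGroup : IsGroup _≡_ _∙_ ε _⁻¹

  Carrier : Set
  Carrier = Fin order

  rawGroup : RawGroup 0ℓ 0ℓ
  rawGroup = record { Carrier = Fin order ; _≈_ = _≡_ ; _∙_ = _∙_ ; ε = ε ; _⁻¹ = _⁻¹ }

open FiniteGroup public using (Carrier; rawGroup)

IsHom : (G H : FiniteGroup) → (Carrier G → Carrier H) → Set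
IsHom G H f = GroupMorphisms.IsGroupHomomorphism (rawGroup G) (rawGroup H) f

IsIso : (G H : FiniteGroup) → (Carrier G → Carrier H) → Set
IsIso G H f = GroupMorphisms.IsGroupIsomorphism (rawGroup G) (rawGroup H) f

_≅_ : FiniteGroup → FiniteGroup → Set
G ≅ H = Σ (Carrier G → Carrier H) (IsIso G H)

IsEndo : (G : FiniteGroup) → (Carrier G → Carrier G) → Set
IsEndo G f = IsHom G G f

NonTrivial : FiniteGroup → Set
NonTrivial G = ∃ λ (x : Carrier G) → x ≢ FiniteGroup.ε G

private
  _+₂_ : Fin 2 → Fin 2 → Fin 2
  zero +₂ y = y
  suc zero +₂ zero = suc zero
  suc zero +₂ suc zero = zero

  +₂-assoc : ∀ x y z → (x +₂ y) +₂ z ≡ x +₂ (y +₂ z)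
  +₂-assoc zero y z = refl
  +₂-assoc (suc zero) zero z = refl
  +₂-assoc (suc zero) (suc zero) zero = refl
  +₂-assoc (suc zero) (suc zero) (suc zero) = refl

  +₂-idʳ : ∀ x → x +₂ zero ≡ x
  +₂-idʳ zero = refl
  +₂-idʳ (suc zero) = refl

  +₂-inv : ∀ x → x +₂ x ≡ zero
  +₂-inv zero = refl
  +₂-inv (suc zero) = refl

ℤ₂ : FiniteGroup
ℤ₂ = record
  { order = 2
  ; _∙_ = _+₂_
  ; ε = zero
  ; _⁻¹ = λ x → x
  ; isGroup = record
    { isMonoid = record
      { isSemigroup = record
        { isMagma = record { isEquivalence = isEquivalence ; ∙-cong = cong₂ _+₂_ }
        ; assoc = +₂-assoc }
      ; identity = (λ x → refl) , +₂-idʳ }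
    ; inverse = +₂-inv , +₂-inv
    ; ⁻¹-cong = λ p → p }
  }

data Walk {V : Set} (R : V → V → Set) : V → V → Set where
  nil  : ∀ {a} → Walk R a a
  cons : ∀ {a b c} → R a b → Walk R b c → Walk R a c

Connected : {V : Set} → (V → V → Set) → Set
Connected {V} R = (a b : V) → Walk R a b

-- A cycle: distinct vertices v ∷ ws (at least three of them), each
-- adjacent to the next, and the last adjacent to v.
HasCycle : {V : Set} → (V → V → Set) → Set
HasCycle {V} R =
  ∃ λ (v : V) → ∃ λ (ws : List V) →
    (2 ≤ length ws) × Unique (v ∷ ws) × Linked R (v ∷ ws ++ [ v ])

-- A tree: a connected acyclic graph (the vertex sets here are nonempty).
IsTree : {V : Set} → (V → V → Set) → Set
IsTree R = Connected R × ¬ HasCycle R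

EndoAdj : (G : FiniteGroup) → Carrier G → Carrier G → Set
EndoAdj G a b =
  a ≢ b ×
  ((∃ λ (f : Carrier G → Carrier G) → IsEndo G f × f a ≡ b) ⊎
   (∃ λ (f : Carrier G → Carrier G) → IsEndo G f × f b ≡ a))

{-# OPTIONS --safe #-}
module Submission where

-- The constant endomorphism makes ε adjacent to every other element, so Endo(G) is
-- connected; and if an endomorphism f sends u ≢ ε to some f u ∉ {ε, u}, then ε, u, f u
-- form a triangle.  So in a tree every endomorphism kills or fixes each element.  Applied
-- to the (injective) conjugations and then to inversion, this makes G abelian of exponent 2,
-- i.e. an 𝔽₂-vector space.  There every a ≢ ε is separated by a character χ : G → ℤ₂,
-- whose kernel is grown greedily as a subgroup avoiding a; composing χ with ℤ₂ → G, 1 ↦ b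
-- sends a to b, so every b is ε or a.  Conversely, two vertices cannot carry a cycle.

open import Defs
open import Level using (0ℓ)
open import Function.Base using (_∘_; id)
open import Function.Bundles using (_⇔_; mk⇔; Equivalence)
open import Function.Definitions using (Injective; Surjective)
open import Data.Nat using (s≤s; z≤n)
open import Data.Bool using (Bool; true; false; T; if_then_else_; _∨_)
open import Data.Bool.Properties using (T-∨; T?)
open import Data.Unit using (tt)
open import Data.Fin using (Fin; zero; suc)
open import Data.Fin.Properties using (_≟_; 0≢1+n)
open import Data.Product using (∃; _×_; _,_)
open import Data.Sum using (_⊎_; inj₁; inj₂; [_,_])
import Data.Sum as Sum
open import Data.Empty using (⊥; ⊥-elim)
open import Data.List using (List; []; _∷_; foldr; allFin)
open import Data.List.Relation.Unary.Any using (here; there)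
open import Data.List.Membership.Propositional using (_∈_)
open import Data.List.Membership.Propositional.Properties using (∈-allFin)
open import Data.List.Relation.Unary.Linked using ([-]; _∷_)
open import Data.List.Relation.Unary.AllPairs using ([]; _∷_)
open import Data.List.Relation.Unary.All using ([]; _∷_)
open import Relation.Nullary using (¬_; yes; no)
open import Relation.Nullary.Decidable using (⌊_⌋; toWitness; fromWitness)
open import Relation.Binary.PropositionalEquality
  using (_≡_; _≢_; refl; sym; trans; cong; cong₂; subst; module ≡-Reasoning)
open import Algebra.Bundles using (Group; AbelianGroup)
import Algebra.Properties.Group as GroupProperties
import Algebra.Properties.Monoid as MonoidProperties
import Algebra.Properties.CommutativeSemigroup as CommutativeSemigroupProperties
open import Algebra.Morphism.Structures using (module GroupMorphisms)
open GroupMorphisms using (module IsGroupHomomorphism; module IsGroupIsomorphism)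
import Algebra.Morphism.Construct.Composition as Composition

toGroup : FiniteGroup → Group 0ℓ 0ℓ
toGroup G = record { isGroup = FiniteGroup.isGroup G }

∙-homo⇒IsHom : (G H : FiniteGroup) (f : Carrier G → Carrier H) →
               (∀ x y → f (FiniteGroup._∙_ G x y) ≡ FiniteGroup._∙_ H (f x) (f y)) →
               IsHom G H f
∙-homo⇒IsHom G H f homo = record
  { isMonoidHomomorphism = record
    { isMagmaHomomorphism = record
      { isRelHomomorphism = record { cong = cong f } ; homo = homo }
    ; ε-homo = ε-homo }
  ; ⁻¹-homo = ⁻¹-homo }
  where
  module G = Group (toGroup G)
  module H = Group (toGroup H)
  open GroupProperties (toGroup H) using (identityʳ-unique; inverseˡ-unique)

  ε-homo : f G.ε ≡ H.ε
  ε-homo = identityʳ-unique (f G.ε) (f G.ε)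
             (trans (sym (homo G.ε G.ε)) (cong f (G.identityˡ G.ε)))

  ⁻¹-homo : ∀ x → f (x G.⁻¹) ≡ f x H.⁻¹
  ⁻¹-homo x = inverseˡ-unique (f (x G.⁻¹)) (f x)
                (trans (sym (homo (x G.⁻¹) x)) (trans (cong f (G.inverseˡ x)) ε-homo))

no-three-distinct-in-Fin2 : (p q r : Fin 2) → p ≢ q → p ≢ r → q ≢ r → ⊥
no-three-distinct-in-Fin2 zero       zero       _          p≢q _   _   = p≢q refl
no-three-distinct-in-Fin2 (suc zero) (suc zero) _          p≢q _   _   = p≢q refl
no-three-distinct-in-Fin2 zero       (suc zero) zero       _   p≢r _   = p≢r refl
no-three-distinct-in-Fin2 (suc zero) zero       (suc zero) _   p≢r _   = p≢r refl
no-three-distinct-in-Fin2 zero       (suc zero) (suc zero) _   _   q≢r = q≢r refl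
no-three-distinct-in-Fin2 (suc zero) zero       zero       _   _   q≢r = q≢r refl

injection-into-Fin2⇒¬HasCycle : {V : Set} {R : V → V → Set} (φ : V → Fin 2) →
                                Injective _≡_ _≡_ φ → ¬ HasCycle R
injection-into-Fin2⇒¬HasCycle φ φ-inj (_ , [] , () , _)
injection-into-Fin2⇒¬HasCycle φ φ-inj (_ , _ ∷ [] , s≤s () , _)
injection-into-Fin2⇒¬HasCycle φ φ-inj
  (v , w₁ ∷ w₂ ∷ _ , _ , (v≢w₁ ∷ v≢w₂ ∷ _) ∷ (w₁≢w₂ ∷ _) ∷ _ , _) =
  no-three-distinct-in-Fin2 (φ v) (φ w₁) (φ w₂)
    (v≢w₁ ∘ φ-inj) (v≢w₂ ∘ φ-inj) (w₁≢w₂ ∘ φ-inj)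

module _ (G : FiniteGroup) where
  open Group (toGroup G) using (_∙_; ε; _⁻¹; assoc; identityˡ; identityʳ; inverseˡ; monoid)
  open GroupProperties (toGroup G) using (∙-cancelˡ; ∙-cancelʳ; ⁻¹-anti-homo-∙; ⁻¹-injective)
  private module M = MonoidProperties monoid
  open ≡-Reasoning

  const-ε-isEndo : IsEndo G (λ _ → ε)
  const-ε-isEndo = ∙-homo⇒IsHom G G (λ _ → ε) (λ _ _ → sym (identityˡ ε))

  adjacent-ε : ∀ {u} → u ≢ ε → EndoAdj G u ε
  adjacent-ε u≢ε = u≢ε , inj₁ (_ , const-ε-isEndo , refl)

  ε-adjacent : ∀ {u} → u ≢ ε → EndoAdj G ε u
  ε-adjacent u≢ε = u≢ε ∘ sym , inj₂ (_ , const-ε-isEndo , refl)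

  Endo-connected : Connected (EndoAdj G)
  Endo-connected u v with u ≟ ε | v ≟ ε
  ... | yes refl | yes refl = nil
  ... | yes refl | no v≢ε   = cons (ε-adjacent v≢ε) nil
  ... | no u≢ε   | yes refl = cons (adjacent-ε u≢ε) nil
  ... | no u≢ε   | no v≢ε   = cons (adjacent-ε u≢ε) (cons (ε-adjacent v≢ε) nil)

  endo-triangle : ∀ {f u} → IsEndo G f → u ≢ ε → f u ≢ ε → u ≢ f u → HasCycle (EndoAdj G)
  endo-triangle {f} {u} f-endo u≢ε fu≢ε u≢fu =
    ε , u ∷ f u ∷ [] , s≤s (s≤s z≤n)
    , ((u≢ε ∘ sym) ∷ (fu≢ε ∘ sym) ∷ []) ∷ (u≢fu ∷ []) ∷ [] ∷ []
    , ε-adjacent u≢ε ∷ (u≢fu , inj₁ (f , f-endo , refl)) ∷ adjacent-ε fu≢ε ∷ [-]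

  conj : Carrier G → Carrier G → Carrier G
  conj x y = x ∙ y ∙ x ⁻¹

  conj-homo : ∀ x y z → conj x (y ∙ z) ≡ conj x y ∙ conj x z
  conj-homo x y z = sym (begin
    (x ∙ y ∙ x ⁻¹) ∙ (x ∙ z ∙ x ⁻¹)    ≡⟨ cong (x ∙ y ∙ x ⁻¹ ∙_) (assoc x z (x ⁻¹)) ⟩
    (x ∙ y ∙ x ⁻¹) ∙ (x ∙ (z ∙ x ⁻¹))  ≡⟨ M.cancelᶜ (inverseˡ x) (x ∙ y) (z ∙ x ⁻¹) ⟩
    (x ∙ y) ∙ (z ∙ x ⁻¹)              ≡⟨ sym (assoc (x ∙ y) z (x ⁻¹)) ⟩
    x ∙ y ∙ z ∙ x ⁻¹                  ≡⟨ cong (_∙ x ⁻¹) (assoc x y z) ⟩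
    x ∙ (y ∙ z) ∙ x ⁻¹                ∎)

  conj-isEndo : ∀ x → IsEndo G (conj x)
  conj-isEndo x = ∙-homo⇒IsHom G G (conj x) (conj-homo x)

  conj-injective : ∀ x → Injective _≡_ _≡_ (conj x)
  conj-injective x {y} {z} eq = ∙-cancelˡ x y z (∙-cancelʳ (x ⁻¹) (x ∙ y) (x ∙ z) eq)

  ⁻¹-isEndo : (∀ x y → x ∙ y ≡ y ∙ x) → IsEndo G _⁻¹
  ⁻¹-isEndo comm =
    ∙-homo⇒IsHom G G _⁻¹ (λ x y → trans (⁻¹-anti-homo-∙ x y) (comm (y ⁻¹) (x ⁻¹)))

  module _ (acyclic : ¬ HasCycle (EndoAdj G)) where

    acyclic⇒endo-kills-or-fixes : ∀ {f} → IsEndo G f → ∀ u → f u ≡ ε ⊎ f u ≡ u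
    acyclic⇒endo-kills-or-fixes {f} f-endo u with u ≟ ε | f u ≟ ε | u ≟ f u
    ... | yes refl | _        | _        = inj₁ (IsGroupHomomorphism.ε-homo f-endo)
    ... | no _     | yes fu≡ε | _        = inj₁ fu≡ε
    ... | no _     | no _     | yes u≡fu = inj₂ (sym u≡fu)
    ... | no u≢ε   | no fu≢ε  | no u≢fu  =
      ⊥-elim (acyclic (endo-triangle f-endo u≢ε fu≢ε u≢fu))

    acyclic⇒injective-endo-fixes : ∀ {f} → IsEndo G f → Injective _≡_ _≡_ f → ∀ u → f u ≡ u
    acyclic⇒injective-endo-fixes {f} f-endo f-inj u
      with acyclic⇒endo-kills-or-fixes f-endo u
    ... | inj₂ fu≡u = fu≡u
    ... | inj₁ fu≡ε = trans fu≡ε (sym u≡ε)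
      where
      u≡ε : u ≡ ε
      u≡ε = f-inj (trans fu≡ε (sym (IsGroupHomomorphism.ε-homo f-endo)))

    acyclic⇒comm : ∀ x y → x ∙ y ≡ y ∙ x
    acyclic⇒comm x y = begin
      x ∙ y         ≡⟨ sym (M.cancelʳ (inverseˡ x) (x ∙ y)) ⟩
      conj x y ∙ x  ≡⟨ cong (_∙ x) conj-x-fixes-y ⟩
      y ∙ x         ∎
      where
      conj-x-fixes-y : conj x y ≡ y
      conj-x-fixes-y = acyclic⇒injective-endo-fixes (conj-isEndo x) (conj-injective x) y

    acyclic⇒square≡ε : ∀ x → x ∙ x ≡ ε
    acyclic⇒square≡ε x = begin
      x ∙ x     ≡⟨ cong (_∙ x) (sym x⁻¹≡x) ⟩
      x ⁻¹ ∙ x  ≡⟨ inverseˡ x ⟩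
      ε         ∎
      where
      x⁻¹≡x : x ⁻¹ ≡ x
      x⁻¹≡x = acyclic⇒injective-endo-fixes (⁻¹-isEndo acyclic⇒comm) ⁻¹-injective x

  open FiniteGroup ℤ₂ using () renaming (_∙_ to _+₂_)

  from-ℤ₂ : Carrier G → Fin 2 → Carrier G
  from-ℤ₂ b zero       = ε
  from-ℤ₂ b (suc zero) = b

  from-ℤ₂-isHom : ∀ {b} → b ∙ b ≡ ε → IsHom ℤ₂ G (from-ℤ₂ b)
  from-ℤ₂-isHom {b} b∙b≡ε = ∙-homo⇒IsHom ℤ₂ G (from-ℤ₂ b) homo
    where
    homo : ∀ i j → from-ℤ₂ b (i +₂ j) ≡ from-ℤ₂ b i ∙ from-ℤ₂ b j
    homo zero       zero       = sym (identityˡ ε)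
    homo zero       (suc zero) = sym (identityˡ b)
    homo (suc zero) zero       = sym (identityʳ b)
    homo (suc zero) (suc zero) = sym b∙b≡ε

  two-elements⇒≅ℤ₂ : ∀ {a χ} → IsHom G ℤ₂ χ → χ a ≡ suc zero →
                     (∀ x → x ≡ ε ⊎ x ≡ a) → G ≅ ℤ₂
  two-elements⇒≅ℤ₂ {a} {χ} χ-hom χa≡1 ε-or-a = χ , record
    { isGroupMonomorphism = record { isGroupHomomorphism = χ-hom ; injective = injective }
    ; surjective = surjective }
    where
    χε≡0 : χ ε ≡ zero
    χε≡0 = IsGroupHomomorphism.ε-homo χ-hom

    injective : Injective _≡_ _≡_ χ
    injective {x} {y} χx≡χy with ε-or-a x | ε-or-a y
    ... | inj₁ refl | inj₁ refl = refl
    ... | inj₂ refl | inj₂ refl = refl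
    ... | inj₁ refl | inj₂ refl = ⊥-elim (0≢1+n (trans (sym χε≡0) (trans χx≡χy χa≡1)))
    ... | inj₂ refl | inj₁ refl = ⊥-elim (0≢1+n (trans (sym χε≡0) (trans (sym χx≡χy) χa≡1)))

    surjective : Surjective _≡_ _≡_ χ
    surjective zero       = ε , λ { refl → χε≡0 }
    surjective (suc zero) = a , λ { refl → χa≡1 }

  -- Subsets are Boolean predicates so that the greedy construction can branch on membership.
  record SubgroupAvoiding (a : Carrier G) (H : Carrier G → Bool) : Set where
    field
      ε∈H      : T (H ε)
      ∙-closed : ∀ {y z} → T (H y) → T (H z) → T (H (y ∙ z))
      a∉H      : ¬ T (H a)

  trivial-avoiding : ∀ {a} → a ≢ ε → SubgroupAvoiding a (λ y → ⌊ y ≟ ε ⌋)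
  trivial-avoiding a≢ε = record
    { ε∈H      = fromWitness refl
    ; ∙-closed = λ y≡ε z≡ε →
        fromWitness (trans (cong₂ _∙_ (toWitness y≡ε) (toWitness z≡ε)) (identityˡ ε))
    ; a∉H      = a≢ε ∘ toWitness }

  module ElementaryAbelian (comm : ∀ x y → x ∙ y ≡ y ∙ x) (square≡ε : ∀ x → x ∙ x ≡ ε) where

    abelianGroup : AbelianGroup 0ℓ 0ℓ
    abelianGroup = record
      { isAbelianGroup = record { isGroup = Group.isGroup (toGroup G) ; comm = comm } }

    open CommutativeSemigroupProperties (AbelianGroup.commutativeSemigroup abelianGroup)
      using (interchange; x∙yz≈y∙xz)

    xy∙xz≡yz : ∀ x y z → (x ∙ y) ∙ (x ∙ z) ≡ y ∙ z
    xy∙xz≡yz x y z = begin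
      (x ∙ y) ∙ (x ∙ z) ≡⟨ interchange x y x z ⟩
      (x ∙ x) ∙ (y ∙ z) ≡⟨ cong (_∙ (y ∙ z)) (square≡ε x) ⟩
      ε ∙ (y ∙ z)       ≡⟨ identityˡ (y ∙ z) ⟩
      y ∙ z             ∎

    adjoin : Carrier G → (Carrier G → Bool) → Carrier G → Bool
    adjoin x H y = H y ∨ H (x ∙ y)

    module _ (H : Carrier G → Bool) where

      adjoin-intro : ∀ {x y} → T (H y) ⊎ T (H (x ∙ y)) → T (adjoin x H y)
      adjoin-intro {y = y} = Equivalence.from (T-∨ {H y})

      adjoin-elim : ∀ {x y} → T (adjoin x H y) → T (H y) ⊎ T (H (x ∙ y))
      adjoin-elim {y = y} = Equivalence.to (T-∨ {H y})

    module _ {a H} (H-avoids : SubgroupAvoiding a H) where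
      open SubgroupAvoiding H-avoids

      adjoin-avoiding : ∀ {x} → ¬ T (H (x ∙ a)) → SubgroupAvoiding a (adjoin x H)
      adjoin-avoiding {x} xa∉H = record
        { ε∈H      = adjoin-intro H (inj₁ ε∈H)
        ; ∙-closed = λ p q → adjoin-intro H (closed (adjoin-elim H p) (adjoin-elim H q))
        ; a∉H      = [ a∉H , xa∉H ] ∘ adjoin-elim H }
        where
        closed : ∀ {y z} → T (H y) ⊎ T (H (x ∙ y)) → T (H z) ⊎ T (H (x ∙ z)) →
                 T (H (y ∙ z)) ⊎ T (H (x ∙ (y ∙ z)))
        closed         (inj₁ y∈H)  (inj₁ z∈H)  = inj₁ (∙-closed y∈H z∈H)
        closed {y} {z} (inj₁ y∈H)  (inj₂ xz∈H) =
          inj₂ (subst (T ∘ H) (sym (x∙yz≈y∙xz x y z)) (∙-closed y∈H xz∈H))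
        closed {y} {z} (inj₂ xy∈H) (inj₁ z∈H)  =
          inj₂ (subst (T ∘ H) (assoc x y z) (∙-closed xy∈H z∈H))
        closed {y} {z} (inj₂ xy∈H) (inj₂ xz∈H) =
          inj₁ (subst (T ∘ H) (xy∙xz≡yz x y z) (∙-closed xy∈H xz∈H))

    module _ {a : Carrier G} (a≢ε : a ≢ ε) where

      extend : Carrier G → (Carrier G → Bool) → Carrier G → Bool
      extend x H = if H (x ∙ a) then H else adjoin x H

      extend-avoiding : ∀ x {H} → SubgroupAvoiding a H → SubgroupAvoiding a (extend x H)
      extend-avoiding x {H} H-avoids with H (x ∙ a) in xa∈?H
      ... | true  = H-avoids
      ... | false = adjoin-avoiding H-avoids (subst T xa∈?H)

      extend-mono : ∀ x H {y} → T (H y) → T (extend x H y)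
      extend-mono x H y∈H with H (x ∙ a)
      ... | true  = y∈H
      ... | false = adjoin-intro H (inj₁ y∈H)

      extend-covers : ∀ x {H} → SubgroupAvoiding a H → T (extend x H x) ⊎ T (extend x H (a ∙ x))
      extend-covers x {H} H-avoids with H (x ∙ a) in xa∈?H
      ... | true  = inj₂ (subst (T ∘ H) (comm x a) (subst T (sym xa∈?H) tt))
      ... | false = inj₁ (adjoin-intro H (inj₂ (subst (T ∘ H) (sym (square≡ε x)) ε∈H)))
        where open SubgroupAvoiding H-avoids

      grow : List (Carrier G) → Carrier G → Bool
      grow = foldr extend (λ y → ⌊ y ≟ ε ⌋)

      grow-avoiding : ∀ xs → SubgroupAvoiding a (grow xs)
      grow-avoiding []       = trivial-avoiding a≢ε
      grow-avoiding (x ∷ xs) = extend-avoiding x (grow-avoiding xs)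

      grow-covers : ∀ {x xs} → x ∈ xs → T (grow xs x) ⊎ T (grow xs (a ∙ x))
      grow-covers {xs = x ∷ xs} (here refl)  = extend-covers x (grow-avoiding xs)
      grow-covers {xs = y ∷ xs} (there x∈xs) =
        Sum.map (extend-mono y (grow xs)) (extend-mono y (grow xs)) (grow-covers x∈xs)

      index-two-subgroup-avoiding :
        ∃ λ H → SubgroupAvoiding a H × (∀ x → T (H x) ⊎ T (H (a ∙ x)))
      index-two-subgroup-avoiding =
        grow (allFin _) , grow-avoiding (allFin _) , λ x → grow-covers (∈-allFin x)

    module Character {a H} (H-avoids : SubgroupAvoiding a H)
                     (H-covers : ∀ x → T (H x) ⊎ T (H (a ∙ x))) where
      open SubgroupAvoiding H-avoids

      ∈∙∉ : ∀ {x y} → T (H x) → ¬ T (H y) → ¬ T (H (x ∙ y))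
      ∈∙∉ {x} {y} x∈H y∉H xy∈H =
        y∉H (subst (T ∘ H) (M.cancelˡ (square≡ε x) y) (∙-closed x∈H xy∈H))

      ∉∙∈ : ∀ {x y} → ¬ T (H x) → T (H y) → ¬ T (H (x ∙ y))
      ∉∙∈ {x} {y} x∉H y∈H xy∈H =
        x∉H (subst (T ∘ H) (M.cancelʳ (square≡ε y) x) (∙-closed xy∈H y∈H))

      ∉∙∉ : ∀ {x y} → ¬ T (H x) → ¬ T (H y) → T (H (x ∙ y))
      ∉∙∉ {x} {y} x∉H y∉H =
        subst (T ∘ H) (xy∙xz≡yz a x y) (∙-closed (a∙-∈ x∉H) (a∙-∈ y∉H))
        where
        a∙-∈ : ∀ {z} → ¬ T (H z) → T (H (a ∙ z))
        a∙-∈ {z} z∉H = [ ⊥-elim ∘ z∉H , id ] (H-covers z)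

      χ : Carrier G → Fin 2
      χ x = if H x then zero else suc zero

      χ-∈ : ∀ {x} → T (H x) → χ x ≡ zero
      χ-∈ {x} x∈H with H x
      ... | true  = refl
      ... | false = ⊥-elim x∈H

      χ-∉ : ∀ {x} → ¬ T (H x) → χ x ≡ suc zero
      χ-∉ {x} x∉H with H x
      ... | true  = ⊥-elim (x∉H tt)
      ... | false = refl

      χ-homo : ∀ x y → χ (x ∙ y) ≡ χ x +₂ χ y
      χ-homo x y with T? (H x) | T? (H y)
      ... | yes x∈H | yes y∈H =
        trans (χ-∈ (∙-closed x∈H y∈H)) (sym (cong₂ _+₂_ (χ-∈ x∈H) (χ-∈ y∈H)))
      ... | yes x∈H | no y∉H  =
        trans (χ-∉ (∈∙∉ x∈H y∉H)) (sym (cong₂ _+₂_ (χ-∈ x∈H) (χ-∉ y∉H)))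
      ... | no x∉H  | yes y∈H =
        trans (χ-∉ (∉∙∈ x∉H y∈H)) (sym (cong₂ _+₂_ (χ-∉ x∉H) (χ-∈ y∈H)))
      ... | no x∉H  | no y∉H  =
        trans (χ-∈ (∉∙∉ x∉H y∉H)) (sym (cong₂ _+₂_ (χ-∉ x∉H) (χ-∉ y∉H)))

      χ-isHom : IsHom G ℤ₂ χ
      χ-isHom = ∙-homo⇒IsHom G ℤ₂ χ χ-homo

      χ-a : χ a ≡ suc zero
      χ-a = χ-∉ a∉H

    separating-character : ∀ {a} → a ≢ ε → ∃ λ χ → IsHom G ℤ₂ χ × χ a ≡ suc zero
    separating-character a≢ε with index-two-subgroup-avoiding a≢ε
    ... | _ , H-avoids , H-covers = χ , χ-isHom , χ-a
      where open Character H-avoids H-covers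

    endo-mapping : ∀ {a} → a ≢ ε → ∀ b → ∃ λ f → IsEndo G f × f a ≡ b
    endo-mapping a≢ε b with separating-character a≢ε
    ... | χ , χ-hom , χa≡1 =
      from-ℤ₂ b ∘ χ ,
      Composition.isGroupHomomorphism trans χ-hom (from-ℤ₂-isHom (square≡ε b)) ,
      cong (from-ℤ₂ b) χa≡1

corollary2p14 : (G : FiniteGroup) → NonTrivial G → (IsTree (EndoAdj G) ⇔ (G ≅ ℤ₂))
corollary2p14 G (a , a≢ε) = mk⇔ tree⇒≅ℤ₂ ≅ℤ₂⇒tree
  where
  open FiniteGroup G using (ε)

  ≅ℤ₂⇒tree : G ≅ ℤ₂ → IsTree (EndoAdj G)
  ≅ℤ₂⇒tree (φ , φ-iso) =
    Endo-connected G , injection-into-Fin2⇒¬HasCycle φ (IsGroupIsomorphism.injective φ-iso)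

  tree⇒≅ℤ₂ : IsTree (EndoAdj G) → G ≅ ℤ₂
  tree⇒≅ℤ₂ (_ , acyclic) =
    let (_ , χ-hom , χa≡1) = separating-character a≢ε
    in  two-elements⇒≅ℤ₂ G χ-hom χa≡1 ε-or-a
    where
    open ElementaryAbelian G (acyclic⇒comm G acyclic) (acyclic⇒square≡ε G acyclic)

    ε-or-a : ∀ x → x ≡ ε ⊎ x ≡ a
    ε-or-a x with endo-mapping a≢ε x
    ... | f , f-endo , refl = acyclic⇒endo-kills-or-fixes G acyclic f-endo a
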